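{- For every integer $n\ge2$, $$\sum_{r=0}^{[n/2]}\binom{n}{2r}\big(2^{2n-2r}-1\big)B_{2n-2r}=0.$$
   Context: The Bernoulli numbers $B_n$ are defined by $B_0=1$ and $\sum_{k=0}^{n-1}\binom nkB_k=0$ for $n\ge2$. $[x]$ denotes the greatest integer not exceeding $x$. -}

module Defs where

open import Data.Nat as ℕ using (ℕ; zero; suc)
open import Data.Nat.Combinatorics using (_C_)
open import Data.Integer as ℤ using (+_)
open import Data.Rational using (ℚ; _+_; _*_; -_; _/_; 0ℚ; 1ℚ)
open import Data.List using (List; []; _∷_; _∷ʳ_; foldr; zipWith; upTo; length; map)

sumℚ : List ℚ → ℚ
sumℚ = foldr _+_ 0ℚ

sumTo : ℕ → (ℕ → ℚ) → ℚ
sumTo n f = sumℚ (map f (upTo (suc n)))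

ℕ→ℚ : ℕ → ℚ
ℕ→ℚ n = (+ n) / 1

nth : List ℚ → ℕ → ℚ
nth []       _       = 0ℚ
nth (x ∷ xs) zero    = x
nth (x ∷ xs) (suc k) = nth xs k

-- bernList n = [B_0, B_1, ..., B_n], computed from the defining recurrence
-- B_0 = 1 and  Σ_{k=0}^{m-1} C(m,k) B_k = 0  for m ≥ 2, i.e. with m = n + 2:
--   B_{n+1} = -(1/(n+2)) Σ_{k=0}^{n} C(n+2,k) B_k
bernList : ℕ → List ℚ
bernList zero    = 1ℚ ∷ []
bernList (suc n) = bs ∷ʳ next
  where
  bs : List ℚ
  bs = bernList n
  next : ℚ
  next = - ((+ 1 / (suc (suc n))) * sumTo n (λ k → ℕ→ℚ ((suc (suc n)) C k) * nth bs k))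

B : ℕ → ℚ
B n = nth (bernList n) n

module Submission where

-- Write BT f m = Σ_{k ≤ m} C(m,k) f k for the binomial transform.  The defining
-- recurrence of the Bernoulli numbers says exactly that B is fixed by BT in every
-- degree m ≥ 2, and B is, up to a scalar, the only such sequence.  Since BT ∘ BT is
-- the transform with weights 2^{m-k}, the sequence BT(2^k B_k) + 2^k B_k is fixed by
-- BT as well; comparing initial values gives BT(2^k B_k) = (2 - 2^k) B_k.  Hence
-- G k = (2^k - 1) B_k is negated by BT in every degree ≥ 2.
--
-- For any such "anti-fixed" g, the double sums
--   E a b = Σ_j C(a,j) g(b+j) + Σ_j C(b,j) (-1)^j g(a+b-j)
-- obey Pascal's rule E a (b+1) = E (a+1) b - E a b and E a 0 = 0 for a ≥ 2, so they
-- vanish for a ≥ 2.  On the diagonal, reversing the first sum gives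
-- E n n = Σ_j (1 + (-1)^j) C(n,j) g(2n-j) = 2 Σ_r C(n,2r) g(2n-2r); taking g = G
-- proves the theorem.

module Proof where

  open import Defs
  open import Data.Nat as ℕ using (ℕ; zero; suc; _∸_; _^_; _≤_; z≤n; s≤s)
  import Data.Nat.Properties as ℕP
  open import Data.Nat.Combinatorics
    using (_C_; nCk+nC[k+1]≡[n+1]C[k+1]; nCn≡1; nCk≡nC[n∸k]; nC1≡n; k>n⇒nCk≡0)
  open import Data.Nat.DivMod using (m/n≡1+[m∸n]/n)
  import Data.Integer as ℤ
  import Data.Integer.Properties as ℤP
  open import Data.Rational using (ℚ; mkℚ; _+_; _*_; -_; _-_; _/_; 0ℚ; 1ℚ)
  import Data.Rational.Properties as ℚP
  open import Algebra.Properties.Group ℚP.+-0-group using (∙-cancelˡ)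
  import Data.Nat.Coprimality as Coprimality
  open import Data.List using (List; []; _∷_; _∷ʳ_; length; map; applyUpTo)
  import Data.List.Properties as ListP
  open import Data.Sum using (inj₁; inj₂)
  open import Relation.Binary.PropositionalEquality
  open import Data.Rational.Solver using (module +-*-Solver)
  open +-*-Solver using (solve; _:+_; _:*_; :-_; _:=_; con)
  open ≡-Reasoning

  ℕ→ℚ≡mkℚ : ∀ n → ℕ→ℚ n ≡ mkℚ (ℤ.+ n) 0 (Coprimality.sym (Coprimality.1-coprimeTo n))
  ℕ→ℚ≡mkℚ n = ℚP.normalize-coprime (Coprimality.sym (Coprimality.1-coprimeTo n))

  ℕ→ℚ-+ : ∀ a b → ℕ→ℚ (a ℕ.+ b) ≡ ℕ→ℚ a + ℕ→ℚ b
  ℕ→ℚ-+ a b rewrite ℕ→ℚ≡mkℚ a | ℕ→ℚ≡mkℚ b =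
    ℚP./-cong {p₁ = ℤ.+ (a ℕ.+ b)}
      (cong₂ ℤ._+_ (sym (ℤP.*-identityʳ (ℤ.+ a))) (sym (ℤP.*-identityʳ (ℤ.+ b)))) refl

  ℕ→ℚ-* : ∀ a b → ℕ→ℚ (a ℕ.* b) ≡ ℕ→ℚ a * ℕ→ℚ b
  ℕ→ℚ-* a b rewrite ℕ→ℚ≡mkℚ a | ℕ→ℚ≡mkℚ b = ℚP./-cong {p₁ = ℤ.+ (a ℕ.* b)} (ℤP.pos-* a b) refl

  1/[1+k]*[1+k]≡1 : ∀ k → (ℤ.+ 1 / suc k) * ℕ→ℚ (suc k) ≡ 1ℚ
  1/[1+k]*[1+k]≡1 k rewrite ℕ→ℚ≡mkℚ (suc k)
                          | ℚP.normalize-coprime {1} {k} (Coprimality.1-coprimeTo (suc k)) =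
    ℚP.*-inverseˡ (mkℚ (ℤ.+ suc k) 0 (Coprimality.sym (Coprimality.1-coprimeTo (suc k))))

  ℕ→ℚ-suc-cancel : ∀ k {x y} → ℕ→ℚ (suc k) * x ≡ ℕ→ℚ (suc k) * y → x ≡ y
  ℕ→ℚ-suc-cancel k {x} {y} eq = begin
    x                                   ≡⟨ unscale x ⟨
    (ℤ.+ 1 / suc k) * (ℕ→ℚ (suc k) * x) ≡⟨ cong ((ℤ.+ 1 / suc k) *_) eq ⟩
    (ℤ.+ 1 / suc k) * (ℕ→ℚ (suc k) * y) ≡⟨ unscale y ⟩
    y                                   ∎
    where
    unscale : ∀ z → (ℤ.+ 1 / suc k) * (ℕ→ℚ (suc k) * z) ≡ z
    unscale z = begin
      (ℤ.+ 1 / suc k) * (ℕ→ℚ (suc k) * z) ≡⟨ ℚP.*-assoc (ℤ.+ 1 / suc k) (ℕ→ℚ (suc k)) z ⟨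
      ((ℤ.+ 1 / suc k) * ℕ→ℚ (suc k)) * z ≡⟨ cong (_* z) (1/[1+k]*[1+k]≡1 k) ⟩
      1ℚ * z                            ≡⟨ ℚP.*-identityˡ z ⟩
      z                                 ∎

  two : ℚ
  two = ℕ→ℚ 2

  x+x≡2x : ∀ x → x + x ≡ two * x
  x+x≡2x x = solve 1 (λ x → x :+ x := con two :* x) refl x

  ∑ : ℕ → (ℕ → ℚ) → ℚ
  ∑ zero    f = f 0
  ∑ (suc n) f = f 0 + ∑ n (λ k → f (suc k))

  infix 2 ∑
  syntax ∑ n (λ k → e) = ∑[ k ≤ n ] e

  sumTo≡∑ : ∀ n f → sumTo n f ≡ ∑ n f
  sumTo≡∑ n f = go n (λ k → k)
    where
    go : ∀ n (g : ℕ → ℕ) → sumℚ (map f (applyUpTo g (suc n))) ≡ (∑[ k ≤ n ] f (g k))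
    go zero    g = ℚP.+-identityʳ (f (g 0))
    go (suc n) g = cong (f (g 0) +_) (go n (λ k → g (suc k)))

  ∑-cong : ∀ n {f g : ℕ → ℚ} → (∀ k → k ≤ n → f k ≡ g k) → ∑ n f ≡ ∑ n g
  ∑-cong zero    eq = eq 0 z≤n
  ∑-cong (suc n) eq = cong₂ _+_ (eq 0 z≤n) (∑-cong n (λ k k≤n → eq (suc k) (s≤s k≤n)))

  ∑-cong′ : ∀ n {f g : ℕ → ℚ} → (∀ k → f k ≡ g k) → ∑ n f ≡ ∑ n g
  ∑-cong′ n eq = ∑-cong n (λ k _ → eq k)

  ∑-last : ∀ n f → ∑ (suc n) f ≡ ∑ n f + f (suc n)
  ∑-last zero    f = refl
  ∑-last (suc n) f = begin
    f 0 + ∑ (suc n) (λ k → f (suc k))          ≡⟨ cong (f 0 +_) (∑-last n (λ k → f (suc k))) ⟩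
    f 0 + (∑ n (λ k → f (suc k)) + f (2 ℕ.+ n)) ≡⟨ ℚP.+-assoc (f 0) _ _ ⟨
    ∑ (suc n) f + f (2 ℕ.+ n)                   ∎

  ∑-+ : ∀ n f g → (∑[ k ≤ n ] (f k + g k)) ≡ ∑ n f + ∑ n g
  ∑-+ zero    f g = refl
  ∑-+ (suc n) f g = trans (cong ((f 0 + g 0) +_) (∑-+ n (λ k → f (suc k)) (λ k → g (suc k))))
    (solve 4 (λ a b c d → (a :+ b) :+ (c :+ d) := (a :+ c) :+ (b :+ d)) refl (f 0) (g 0) _ _)

  ∑-* : ∀ n a f → (∑[ k ≤ n ] (a * f k)) ≡ a * ∑ n f
  ∑-* zero    a f = refl
  ∑-* (suc n) a f = trans (cong (a * f 0 +_) (∑-* n a (λ k → f (suc k))))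
    (sym (ℚP.*-distribˡ-+ a (f 0) _))

  ∑-reverse : ∀ n h → ∑ n h ≡ (∑[ j ≤ n ] h (n ∸ j))
  ∑-reverse zero    h = refl
  ∑-reverse (suc n) h = begin
    h 0 + (∑[ j ≤ n ] h (suc j))           ≡⟨ cong (h 0 +_) (∑-reverse n (λ j → h (suc j))) ⟩
    h 0 + (∑[ j ≤ n ] h (suc (n ∸ j)))     ≡⟨ cong (h 0 +_) (∑-cong n (λ j j≤n →
                                                cong h (sym (ℕP.+-∸-assoc 1 j≤n)))) ⟩
    h 0 + (∑[ j ≤ n ] h (suc n ∸ j))       ≡⟨ ℚP.+-comm (h 0) _ ⟩
    (∑[ j ≤ n ] h (suc n ∸ j)) + h 0       ≡⟨ cong (λ e → (∑[ j ≤ n ] h (suc n ∸ j)) + h e) (ℕP.n∸n≡0 n) ⟨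
    (∑[ j ≤ n ] h (suc n ∸ j)) + h (n ∸ n) ≡⟨ ∑-last n (λ j → h (suc n ∸ j)) ⟨
    (∑[ j ≤ suc n ] h (suc n ∸ j))         ∎

  binom : ℕ → ℕ → ℚ
  binom n k = ℕ→ℚ (n C k)

  binom-pascal : ∀ n k → binom (suc n) (suc k) ≡ binom n k + binom n (suc k)
  binom-pascal n k = trans (cong ℕ→ℚ (sym (nCk+nC[k+1]≡[n+1]C[k+1] n k))) (ℕ→ℚ-+ (n C k) (n C suc k))

  binom-[1+n]n : ∀ n → binom (suc n) n ≡ ℕ→ℚ (suc n)
  binom-[1+n]n n = cong ℕ→ℚ (begin
    suc n C n           ≡⟨ nCk≡nC[n∸k] (ℕP.n≤1+n n) ⟩
    suc n C (suc n ∸ n) ≡⟨ cong (suc n C_) (ℕP.m+n∸n≡m 1 n) ⟩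
    suc n C 1           ≡⟨ nC1≡n (suc n) ⟩
    suc n               ∎)

  BT : (ℕ → ℚ) → ℕ → ℚ
  BT f m = ∑[ k ≤ m ] (binom m k * f k)

  BT-cong : ∀ m {f g : ℕ → ℚ} → (∀ k → k ≤ m → f k ≡ g k) → BT f m ≡ BT g m
  BT-cong m eq = ∑-cong m (λ k k≤m → cong (binom m k *_) (eq k k≤m))

  BT-+ : ∀ m f g → BT (λ k → f k + g k) m ≡ BT f m + BT g m
  BT-+ m f g = trans (∑-cong′ m (λ k → ℚP.*-distribˡ-+ (binom m k) (f k) (g k)))
                     (∑-+ m (λ k → binom m k * f k) (λ k → binom m k * g k))

  BT-* : ∀ m a f → BT (λ k → a * f k) m ≡ a * BT f m
  BT-* m a f = trans (∑-cong′ m (λ k → solve 3 (λ x y z → x :* (y :* z) := y :* (x :* z))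
                                                 refl (binom m k) a (f k)))
                     (∑-* m a (λ k → binom m k * f k))

  BT-extend : ∀ m f → (∑[ k ≤ suc m ] (binom m k * f k)) ≡ BT f m
  BT-extend m f = begin
    (∑[ k ≤ suc m ] (binom m k * f k))   ≡⟨ ∑-last m (λ k → binom m k * f k) ⟩
    BT f m + ℕ→ℚ (m C suc m) * f (suc m) ≡⟨ cong (λ z → BT f m + ℕ→ℚ z * f (suc m))
                                                 (k>n⇒nCk≡0 (ℕP.n<1+n m)) ⟩
    BT f m + 0ℚ * f (suc m)              ≡⟨ cong (BT f m +_) (ℚP.*-zeroˡ (f (suc m))) ⟩
    BT f m + 0ℚ                          ≡⟨ ℚP.+-identityʳ (BT f m) ⟩
    BT f m                               ∎

  BT-suc : ∀ m f → BT f (suc m) ≡ BT f m + BT (λ k → f (suc k)) m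
  BT-suc m f = begin
    f₀ + (∑[ k ≤ m ] (binom (suc m) (suc k) * f (suc k)))
      ≡⟨ cong (f₀ +_) (∑-cong′ m (λ k → trans (cong (_* f (suc k)) (binom-pascal m k))
                                              (ℚP.*-distribʳ-+ (f (suc k)) (binom m k) _))) ⟩
    f₀ + (∑[ k ≤ m ] (binom m k * f (suc k) + binom m (suc k) * f (suc k)))
      ≡⟨ cong (f₀ +_) (∑-+ m (λ k → binom m k * f (suc k)) (λ k → binom m (suc k) * f (suc k))) ⟩
    f₀ + (BT (λ k → f (suc k)) m + (∑[ k ≤ m ] (binom m (suc k) * f (suc k))))
      ≡⟨ solve 3 (λ a x y → a :+ (x :+ y) := (a :+ y) :+ x) refl f₀ (BT (λ k → f (suc k)) m) _ ⟩
    (∑[ k ≤ suc m ] (binom m k * f k)) + BT (λ k → f (suc k)) m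
      ≡⟨ cong (_+ BT (λ k → f (suc k)) m) (BT-extend m f) ⟩
    BT f m + BT (λ k → f (suc k)) m
      ∎
    where
    f₀ : ℚ
    f₀ = binom m 0 * f 0

  BT₂ : (ℕ → ℚ) → ℕ → ℚ
  BT₂ f m = BT (λ k → ℕ→ℚ (2 ^ (m ∸ k)) * f k) m

  BT₂-+ : ∀ m f g → BT₂ (λ k → f k + g k) m ≡ BT₂ f m + BT₂ g m
  BT₂-+ m f g = trans (BT-cong m (λ k _ → ℚP.*-distribˡ-+ (ℕ→ℚ (2 ^ (m ∸ k))) (f k) (g k)))
                      (BT-+ m _ _)

  BT₂-suc : ∀ m f → BT₂ f (suc m) ≡ two * BT₂ f m + BT₂ (λ k → f (suc k)) m
  BT₂-suc m f = trans (BT-suc m (λ k → ℕ→ℚ (2 ^ (suc m ∸ k)) * f k))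
                      (cong (_+ BT₂ (λ k → f (suc k)) m) doubled)
    where
    doubled : BT (λ k → ℕ→ℚ (2 ^ (suc m ∸ k)) * f k) m ≡ two * BT₂ f m
    doubled = trans (BT-cong m (λ k k≤m → begin
        ℕ→ℚ (2 ^ (suc m ∸ k)) * f k             ≡⟨ cong (λ e → ℕ→ℚ (2 ^ e) * f k) (ℕP.+-∸-assoc 1 k≤m) ⟩
        ℕ→ℚ (2 ℕ.* 2 ^ (m ∸ k)) * f k           ≡⟨ cong (_* f k) (ℕ→ℚ-* 2 (2 ^ (m ∸ k))) ⟩
        (two * ℕ→ℚ (2 ^ (m ∸ k))) * f k         ≡⟨ ℚP.*-assoc two (ℕ→ℚ (2 ^ (m ∸ k))) (f k) ⟩
        two * (ℕ→ℚ (2 ^ (m ∸ k)) * f k)         ∎))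
      (BT-* m two _)

  BT∘BT≡BT₂ : ∀ m f → BT (BT f) m ≡ BT₂ f m
  BT∘BT≡BT₂ zero    f = refl
  BT∘BT≡BT₂ (suc m) f = begin
    BT (BT f) (suc m)                                   ≡⟨ BT-suc m (BT f) ⟩
    BT (BT f) m + BT (λ k → BT f (suc k)) m             ≡⟨ cong₂ _+_ (BT∘BT≡BT₂ m f)
                                                             (∑-cong′ m (λ k → cong (binom m k *_) (shifted k))) ⟩
    BT₂ f m + BT (BT (λ k → f k + f (suc k))) m         ≡⟨ cong (BT₂ f m +_) (BT∘BT≡BT₂ m _) ⟩
    BT₂ f m + BT₂ (λ k → f k + f (suc k)) m             ≡⟨ cong (BT₂ f m +_) (BT₂-+ m f (λ k → f (suc k))) ⟩
    BT₂ f m + (BT₂ f m + BT₂ (λ k → f (suc k)) m)       ≡⟨ ℚP.+-assoc (BT₂ f m) _ _ ⟨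
    (BT₂ f m + BT₂ f m) + BT₂ (λ k → f (suc k)) m       ≡⟨ cong (_+ BT₂ (λ k → f (suc k)) m) (x+x≡2x (BT₂ f m)) ⟩
    two * BT₂ f m + BT₂ (λ k → f (suc k)) m             ≡⟨ BT₂-suc m f ⟨
    BT₂ f (suc m)                                       ∎
    where
    shifted : ∀ k → BT f (suc k) ≡ BT (λ j → f j + f (suc j)) k
    shifted k = trans (BT-suc k f) (sym (BT-+ k f (λ j → f (suc j))))

  BT₂-scaled : ∀ m f → BT₂ (λ k → ℕ→ℚ (2 ^ k) * f k) m ≡ ℕ→ℚ (2 ^ m) * BT f m
  BT₂-scaled m f = trans (BT-cong m (λ k k≤m → begin
      ℕ→ℚ (2 ^ (m ∸ k)) * (ℕ→ℚ (2 ^ k) * f k)   ≡⟨ ℚP.*-assoc (ℕ→ℚ (2 ^ (m ∸ k))) (ℕ→ℚ (2 ^ k)) (f k) ⟨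
      (ℕ→ℚ (2 ^ (m ∸ k)) * ℕ→ℚ (2 ^ k)) * f k   ≡⟨ cong (_* f k) (ℕ→ℚ-* (2 ^ (m ∸ k)) (2 ^ k)) ⟨
      ℕ→ℚ (2 ^ (m ∸ k) ℕ.* 2 ^ k) * f k         ≡⟨ cong (λ e → ℕ→ℚ e * f k) (ℕP.^-distribˡ-+-* 2 (m ∸ k) k) ⟨
      ℕ→ℚ (2 ^ (m ∸ k ℕ.+ k)) * f k             ≡⟨ cong (λ e → ℕ→ℚ (2 ^ e) * f k) (ℕP.m∸n+n≡m k≤m) ⟩
      ℕ→ℚ (2 ^ m) * f k                         ∎))
    (BT-* m (ℕ→ℚ (2 ^ m)) f)

  -- Sequences fixed by the binomial transform in every degree m ≥ 2.  With a 0 = 1 this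
  -- is exactly the defining recurrence of the Bernoulli numbers, since C(m,m) = 1.

  BT-Fixed : (ℕ → ℚ) → Set
  BT-Fixed a = ∀ n → BT a (2 ℕ.+ n) ≡ a (2 ℕ.+ n)

  lowerSum : (ℕ → ℚ) → ℕ → ℚ
  lowerSum a n = ∑[ k ≤ n ] (binom (2 ℕ.+ n) k * a k)

  BT-top : ∀ n a → BT a (2 ℕ.+ n) ≡ (lowerSum a n + ℕ→ℚ (2 ℕ.+ n) * a (suc n)) + a (2 ℕ.+ n)
  BT-top n a = begin
    BT a m
      ≡⟨ ∑-last (suc n) (λ k → binom m k * a k) ⟩
    (∑[ k ≤ suc n ] (binom m k * a k)) + binom m m * a m
      ≡⟨ cong₂ _+_ (∑-last n (λ k → binom m k * a k)) (cong (λ z → ℕ→ℚ z * a m) (nCn≡1 m)) ⟩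
    (lowerSum a n + binom m (suc n) * a (suc n)) + 1ℚ * a m
      ≡⟨ cong₂ (λ u v → (lowerSum a n + u * a (suc n)) + v) (binom-[1+n]n (suc n)) (ℚP.*-identityˡ (a m)) ⟩
    (lowerSum a n + ℕ→ℚ m * a (suc n)) + a m
      ∎
    where
    m = 2 ℕ.+ n

  fixed⇒recurrence : ∀ {a} → BT-Fixed a → ∀ n → lowerSum a n + ℕ→ℚ (2 ℕ.+ n) * a (suc n) ≡ 0ℚ
  fixed⇒recurrence {a} fixed n = begin
    X             ≡⟨ solve 2 (λ x y → x := (x :+ y) :+ :- y) refl X y ⟩
    (X + y) + - y ≡⟨ cong (λ z → z + - y) (trans (sym (BT-top n a)) (fixed n)) ⟩
    y + - y       ≡⟨ ℚP.+-inverseʳ y ⟩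
    0ℚ            ∎
    where
    X = lowerSum a n + ℕ→ℚ (2 ℕ.+ n) * a (suc n)
    y = a (2 ℕ.+ n)

  fixed-unique : ∀ {a b} → BT-Fixed a → BT-Fixed b → a 0 ≡ b 0 → ∀ k → a k ≡ b k
  fixed-unique {a} {b} fixed-a fixed-b a₀≡b₀ k = agree k k ℕP.≤-refl
    where
    agree : ∀ n k → k ≤ n → a k ≡ b k
    agree zero    zero    _   = a₀≡b₀
    agree (suc n) k       k≤n with ℕP.m≤n⇒m<n∨m≡n k≤n
    ... | inj₁ (s≤s k≤n′) = agree n k k≤n′
    ... | inj₂ refl       = ℕ→ℚ-suc-cancel (suc n) (cancel-lower (trans (fixed⇒recurrence fixed-a n)
                                                          (sym (fixed⇒recurrence fixed-b n))))
      where
      lower≡ : lowerSum a n ≡ lowerSum b n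
      lower≡ = ∑-cong n (λ j j≤n → cong (binom (2 ℕ.+ n) j *_) (agree n j j≤n))
      cancel-lower : ∀ {x y} → lowerSum a n + x ≡ lowerSum b n + y → x ≡ y
      cancel-lower {x} {y} eq = ∙-cancelˡ (lowerSum b n) x y (trans (cong (_+ x) (sym lower≡)) eq)

  length-bernList : ∀ n → length (bernList n) ≡ suc n
  length-bernList zero    = refl
  length-bernList (suc n) = trans (ListP.length-++ (bernList n))
                                  (trans (ℕP.+-comm _ 1) (cong suc (length-bernList n)))

  nth-∷ʳ-< : ∀ (xs : List ℚ) y k → k ℕ.< length xs → nth (xs ∷ʳ y) k ≡ nth xs k
  nth-∷ʳ-< (x ∷ xs) y zero    _         = refl
  nth-∷ʳ-< (x ∷ xs) y (suc k) (s≤s k<n) = nth-∷ʳ-< xs y k k<n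

  nth-∷ʳ-length : ∀ (xs : List ℚ) y → nth (xs ∷ʳ y) (length xs) ≡ y
  nth-∷ʳ-length []       y = refl
  nth-∷ʳ-length (x ∷ xs) y = nth-∷ʳ-length xs y

  nth-bernList : ∀ n k → k ≤ n → nth (bernList n) k ≡ B k
  nth-bernList zero    zero _   = refl
  nth-bernList (suc n) k  k≤n with ℕP.m≤n⇒m<n∨m≡n k≤n
  ... | inj₂ refl       = refl
  ... | inj₁ (s≤s k≤n′) =
    trans (nth-∷ʳ-< (bernList n) _ k (subst (k ℕ.<_) (sym (length-bernList n)) (s≤s k≤n′)))
          (nth-bernList n k k≤n′)

  B-suc : ∀ n → B (suc n) ≡ - ((ℤ.+ 1 / (2 ℕ.+ n)) * lowerSum B n)
  B-suc n = begin
    nth (bernList n ∷ʳ next) (suc n)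
      ≡⟨ subst (λ i → nth (bernList n ∷ʳ next) i ≡ next) (length-bernList n)
               (nth-∷ʳ-length (bernList n) next) ⟩
    next
      ≡⟨ cong (λ z → - ((ℤ.+ 1 / (2 ℕ.+ n)) * z)) (trans (sumTo≡∑ n _) (∑-cong n (λ k k≤n →
           cong (binom (2 ℕ.+ n) k *_) (nth-bernList n k k≤n)))) ⟩
    - ((ℤ.+ 1 / (2 ℕ.+ n)) * lowerSum B n)
      ∎
    where
    next = - ((ℤ.+ 1 / (2 ℕ.+ n)) * sumTo n (λ k → ℕ→ℚ ((2 ℕ.+ n) C k) * nth (bernList n) k))

  B-fixed : BT-Fixed B
  B-fixed n = begin
    BT B m                            ≡⟨ BT-top n B ⟩
    (X + ℕ→ℚ m * B (suc n)) + B m     ≡⟨ cong (λ z → (X + ℕ→ℚ m * z) + B m) (B-suc n) ⟩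
    (X + ℕ→ℚ m * - (i * X)) + B m     ≡⟨ cong (_+ B m) (solve 3 (λ x d i → x :+ d :* (:- (i :* x))
                                                                    := x :+ :- ((i :* d) :* x))
                                                              refl X (ℕ→ℚ m) i) ⟩
    (X + - ((i * ℕ→ℚ m) * X)) + B m   ≡⟨ cong (λ z → (X + - (z * X)) + B m) (1/[1+k]*[1+k]≡1 (suc n)) ⟩
    (X + - (1ℚ * X)) + B m            ≡⟨ solve 2 (λ x b → (x :+ :- (con 1ℚ :* x)) :+ b := b) refl X (B m) ⟩
    B m                               ∎
    where
    m = 2 ℕ.+ n
    X = lowerSum B n
    i = ℤ.+ 1 / m

  fixed⇒multiple-of-B : ∀ {a} → BT-Fixed a → ∀ k → a k ≡ a 0 * B k
  fixed⇒multiple-of-B {a} fixed =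
    fixed-unique fixed (λ n → trans (BT-* (2 ℕ.+ n) (a 0) B) (cong (a 0 *_) (B-fixed n)))
                 (sym (ℚP.*-identityʳ (a 0)))

  -- The key identity  Σ_j C(k,j) 2^j B_j = (2 - 2^k) B_k:  the left side plus 2^k B_k is a
  -- fixed sequence, because BT ∘ BT = BT₂, with initial value 2.

  scaledB : ℕ → ℚ
  scaledB k = ℕ→ℚ (2 ^ k) * B k

  BT-scaledB : ∀ k → BT scaledB k + scaledB k ≡ two * B k
  BT-scaledB = fixed⇒multiple-of-B fixed
    where
    fixed : BT-Fixed (λ k → BT scaledB k + scaledB k)
    fixed n = begin
      BT (λ k → BT scaledB k + scaledB k) m ≡⟨ BT-+ m (BT scaledB) scaledB ⟩
      BT (BT scaledB) m + BT scaledB m      ≡⟨ cong (_+ BT scaledB m) (BT∘BT≡BT₂ m scaledB) ⟩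
      BT₂ scaledB m + BT scaledB m          ≡⟨ cong (_+ BT scaledB m) (BT₂-scaled m B) ⟩
      ℕ→ℚ (2 ^ m) * BT B m + BT scaledB m   ≡⟨ cong (λ z → ℕ→ℚ (2 ^ m) * z + BT scaledB m) (B-fixed n) ⟩
      scaledB m + BT scaledB m              ≡⟨ ℚP.+-comm (scaledB m) _ ⟩
      BT scaledB m + scaledB m              ∎
      where
      m = 2 ℕ.+ n

  BT-AntiFixed : (ℕ → ℚ) → Set
  BT-AntiFixed g = ∀ n → BT g (2 ℕ.+ n) + g (2 ℕ.+ n) ≡ 0ℚ

  G : ℕ → ℚ
  G k = (ℕ→ℚ (2 ^ k) - ℕ→ℚ 1) * B k

  G-antifixed : BT-AntiFixed G
  G-antifixed n = begin
    BT G m + G m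
      ≡⟨ cong (_+ G m) (BT-cong m (λ k _ → G≡ k)) ⟩
    BT (λ k → scaledB k + - 1ℚ * B k) m + G m
      ≡⟨ cong (_+ G m) (BT-+ m scaledB (λ k → - 1ℚ * B k)) ⟩
    (BT scaledB m + BT (λ k → - 1ℚ * B k) m) + G m
      ≡⟨ cong (λ z → (BT scaledB m + z) + G m) (trans (BT-* m (- 1ℚ) B) (cong (- 1ℚ *_) (B-fixed n))) ⟩
    (BT scaledB m + - 1ℚ * B m) + G m
      ≡⟨ solve 3 (λ t p b → (t :+ :- con 1ℚ :* b) :+ (p :+ :- con 1ℚ) :* b := (t :+ p :* b) :+ :- (con two :* b))
               refl (BT scaledB m) (ℕ→ℚ (2 ^ m)) (B m) ⟩
    (BT scaledB m + scaledB m) + - (two * B m)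
      ≡⟨ cong (_+ - (two * B m)) (BT-scaledB m) ⟩
    two * B m + - (two * B m)
      ≡⟨ ℚP.+-inverseʳ (two * B m) ⟩
    0ℚ
      ∎
    where
    m = 2 ℕ.+ n
    G≡ : ∀ k → G k ≡ scaledB k + - 1ℚ * B k
    G≡ k = solve 2 (λ p b → (p :+ :- con 1ℚ) :* b := p :* b :+ :- con 1ℚ :* b) refl (ℕ→ℚ (2 ^ k)) (B k)

  σ : ℕ → ℚ
  σ 0             = 1ℚ
  σ 1             = - 1ℚ
  σ (suc (suc j)) = σ j

  -- Defining σ by a two-step recursion makes σ (j + 2) = σ j hold by computation.
  σ-suc : ∀ j → σ (suc j) ≡ - σ j
  σ-suc 0             = refl
  σ-suc 1             = refl
  σ-suc (suc (suc j)) = σ-suc j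

  ∑-even-part : ∀ n h → (∑[ j ≤ n ] ((1ℚ + σ j) * h j)) ≡ two * (∑[ r ≤ n ℕ./ 2 ] h (2 ℕ.* r))
  ∑-even-part 0             h = refl
  ∑-even-part 1             h = solve 2 (λ x y → con two :* x :+ con 0ℚ :* y := con two :* x) refl (h 0) (h 1)
  ∑-even-part (suc (suc n)) h = begin
    two * h 0 + (0ℚ * h 1 + (∑[ j ≤ n ] ((1ℚ + σ j) * h (2 ℕ.+ j))))
      ≡⟨ cong (λ z → two * h 0 + (0ℚ * h 1 + z)) (∑-even-part n (λ j → h (2 ℕ.+ j))) ⟩
    two * h 0 + (0ℚ * h 1 + two * S)
      ≡⟨ solve 3 (λ x y s → con two :* x :+ (con 0ℚ :* y :+ con two :* s) := con two :* (x :+ s))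
               refl (h 0) (h 1) S ⟩
    two * (h 0 + S)
      ≡⟨ cong (λ z → two * (h 0 + z)) (∑-cong′ (n ℕ./ 2) (λ r → cong h (double-suc r))) ⟩
    two * (∑[ r ≤ suc (n ℕ./ 2) ] h (2 ℕ.* r))
      ≡⟨ cong (λ e → two * (∑[ r ≤ e ] h (2 ℕ.* r))) (m/n≡1+[m∸n]/n {2 ℕ.+ n} {2} (s≤s (s≤s z≤n))) ⟨
    two * (∑[ r ≤ (2 ℕ.+ n) ℕ./ 2 ] h (2 ℕ.* r))
      ∎
    where
    S = ∑[ r ≤ n ℕ./ 2 ] h (2 ℕ.+ 2 ℕ.* r)
    double-suc : ∀ r → 2 ℕ.+ 2 ℕ.* r ≡ 2 ℕ.* suc r
    double-suc r = sym (ℕP.*-distribˡ-+ 2 1 r)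

  module _ (g : ℕ → ℚ) where

    T U E : ℕ → ℕ → ℚ
    T a b = BT (λ j → g (b ℕ.+ j)) a
    U a b = BT (λ j → σ j * g ((b ℕ.+ a) ∸ j)) b
    E a b = T a b + U a b

    -- Pascal's rule moves one unit between the two indices of T, and of U (with a sign).
    T-suc : ∀ a b → T (suc a) b ≡ T a b + T a (suc b)
    T-suc a b = trans (BT-suc a (λ j → g (b ℕ.+ j)))
                      (cong (T a b +_) (BT-cong a (λ j _ → cong g (ℕP.+-suc b j))))

    U-suc : ∀ a b → U a (suc b) ≡ U (suc a) b + - U a b
    U-suc a b = trans (BT-suc b (λ j → σ j * g ((suc b ℕ.+ a) ∸ j)))
                      (cong₂ _+_ (BT-cong b (λ j _ → cong (λ e → σ j * g (e ∸ j)) (sym (ℕP.+-suc b a))))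
                                 (trans (BT-cong b (λ j _ → negated j))
                                        (trans (BT-* b (- 1ℚ) _)
                                               (solve 1 (λ u → :- con 1ℚ :* u := :- u) refl (U a b)))))
      where
      negated : ∀ j → σ (suc j) * g ((b ℕ.+ a) ∸ j) ≡ - 1ℚ * (σ j * g ((b ℕ.+ a) ∸ j))
      negated j = trans (cong (_* g ((b ℕ.+ a) ∸ j)) (σ-suc j))
                        (solve 2 (λ s x → :- s :* x := :- con 1ℚ :* (s :* x)) refl (σ j) (g ((b ℕ.+ a) ∸ j)))

    E-suc : ∀ a b → E a (suc b) ≡ E (suc a) b + - E a b
    E-suc a b = begin
      T a (suc b) + U a (suc b)
        ≡⟨ cong (T a (suc b) +_) (U-suc a b) ⟩
      T a (suc b) + (U (suc a) b + - U a b)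
        ≡⟨ solve 4 (λ t t′ u′ u → t′ :+ (u′ :+ :- u) := ((t :+ t′) :+ u′) :+ :- (t :+ u))
                 refl (T a b) (T a (suc b)) (U (suc a) b) (U a b) ⟩
      ((T a b + T a (suc b)) + U (suc a) b) + - E a b
        ≡⟨ cong (λ z → (z + U (suc a) b) + - E a b) (T-suc a b) ⟨
      E (suc a) b + - E a b
        ∎

    E-zero : ∀ a → E a 0 ≡ BT g a + g a
    E-zero a = cong (BT g a +_) (trans (ℚP.*-identityˡ (1ℚ * g a)) (ℚP.*-identityˡ (g a)))

    E-vanishes : BT-AntiFixed g → ∀ b a → E (2 ℕ.+ a) b ≡ 0ℚ
    E-vanishes anti zero    a = trans (E-zero (2 ℕ.+ a)) (anti a)
    E-vanishes anti (suc b) a = begin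
      E (2 ℕ.+ a) (suc b)             ≡⟨ E-suc (2 ℕ.+ a) b ⟩
      E (3 ℕ.+ a) b + - E (2 ℕ.+ a) b ≡⟨ cong₂ (λ u v → u + - v) (E-vanishes anti b (suc a))
                                                                 (E-vanishes anti b a) ⟩
      0ℚ                              ∎

    h : ℕ → ℕ → ℚ
    h n j = binom n j * g (2 ℕ.* n ∸ j)

    -- On the diagonal, reversing T turns both halves of E into sums of h n j.
    E-diagonal : ∀ n → E n n ≡ (∑[ j ≤ n ] ((1ℚ + σ j) * h n j))
    E-diagonal n = begin
      T n n + U n n                          ≡⟨ cong₂ _+_ T-reflected (∑-cong′ n U-term) ⟩
      ∑ n (h n) + (∑[ j ≤ n ] (σ j * h n j)) ≡⟨ ∑-+ n (h n) (λ j → σ j * h n j) ⟨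
      (∑[ j ≤ n ] (h n j + σ j * h n j))     ≡⟨ ∑-cong′ n (λ j → solve 2 (λ x s → x :+ s :* x := (con 1ℚ :+ s) :* x)
                                                                        refl (h n j) (σ j)) ⟩
      (∑[ j ≤ n ] ((1ℚ + σ j) * h n j))      ∎
      where
      n+n≡2n : n ℕ.+ n ≡ 2 ℕ.* n
      n+n≡2n = cong (n ℕ.+_) (sym (ℕP.+-identityʳ n))

      T-reflected : T n n ≡ ∑ n (h n)
      T-reflected = trans (∑-reverse n (λ j → binom n j * g (n ℕ.+ j))) (∑-cong n (λ j j≤n →
        cong₂ (λ c e → ℕ→ℚ c * g e)
              (sym (nCk≡nC[n∸k] j≤n))
              (trans (sym (ℕP.+-∸-assoc n j≤n)) (cong (_∸ j) n+n≡2n))))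

      U-term : ∀ j → binom n j * (σ j * g ((n ℕ.+ n) ∸ j)) ≡ σ j * h n j
      U-term j = trans (cong (λ e → binom n j * (σ j * g (e ∸ j))) n+n≡2n)
                       (solve 3 (λ c s x → c :* (s :* x) := s :* (c :* x))
                                refl (binom n j) (σ j) (g (2 ℕ.* n ∸ j)))

    antifixed⇒even-binomial-sum : BT-AntiFixed g → ∀ n → 2 ≤ n →
      (∑[ r ≤ n ℕ./ 2 ] (binom n (2 ℕ.* r) * g (2 ℕ.* n ∸ 2 ℕ.* r))) ≡ 0ℚ
    antifixed⇒even-binomial-sum anti n@(suc (suc m)) (s≤s (s≤s _)) = ℕ→ℚ-suc-cancel 1 (begin
      two * (∑[ r ≤ n ℕ./ 2 ] h n (2 ℕ.* r)) ≡⟨ ∑-even-part n (h n) ⟨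
      (∑[ j ≤ n ] ((1ℚ + σ j) * h n j))      ≡⟨ E-diagonal n ⟨
      E n n                                  ≡⟨ E-vanishes anti n m ⟩
      0ℚ                                     ≡⟨ ℚP.*-zeroʳ two ⟨
      two * 0ℚ                               ∎)


open Proof using (∑; sumTo≡∑; ∑-cong′; G; G-antifixed; antifixed⇒even-binomial-sum)
open import Defs
open import Data.Nat using (ℕ; _≤_; _*_; _∸_; _^_; _/_)
open import Data.Nat.Combinatorics using (_C_)
open import Data.Rational using (ℚ; 0ℚ; _-_) renaming (_*_ to _*ℚ_)
import Data.Rational.Properties as ℚP
open import Relation.Binary.PropositionalEquality using (_≡_)
open import Relation.Binary.PropositionalEquality.Properties using (module ≡-Reasoning)
open ≡-Reasoning

corollary2p4 : (n : ℕ) → 2 ≤ n →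
    sumTo (n / 2) (λ r → ℕ→ℚ (n C (2 * r)) *ℚ (ℕ→ℚ (2 ^ (2 * n ∸ 2 * r)) - ℕ→ℚ 1) *ℚ B (2 * n ∸ 2 * r)) ≡ 0ℚ
corollary2p4 n 2≤n = begin
  sumTo (n / 2) summand                                    ≡⟨ sumTo≡∑ (n / 2) summand ⟩
  ∑ (n / 2) summand                                        ≡⟨ ∑-cong′ (n / 2) (λ r →
                                                                ℚP.*-assoc (ℕ→ℚ (n C (2 * r))) _ _) ⟩
  ∑ (n / 2) (λ r → ℕ→ℚ (n C (2 * r)) *ℚ G (2 * n ∸ 2 * r)) ≡⟨ antifixed⇒even-binomial-sum G G-antifixed n 2≤n ⟩
  0ℚ                                                       ∎
  where
  summand : ℕ → ℚ
  summand r = ℕ→ℚ (n C (2 * r)) *ℚ (ℕ→ℚ (2 ^ (2 * n ∸ 2 * r)) - ℕ→ℚ 1) *ℚ B (2 * n ∸ 2 * r)
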